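{- Let $F_1:\mathbf{Sets}\times\mathbf{Sets}\to\mathbf{Sets}\times\mathbf{Sets}$ be given by $F_1(V,E)=(1,\mathcal{P}(V\uplus E))$ and $F_1(f_V,f_E)=(\mathrm{id}_1,\mathcal{P}(f_V\uplus f_E))$, and let $\mathcal{M}$ be the class of morphisms $(f_V,f_E)$ of $\mathbf{Coalg}_{F_1}$ with both $f_V$ and $f_E$ injective. Then $(\mathbf{Coalg}_{F_1},\mathcal{M})$ is an $\mathcal{M}$-adhesive category.
   Context: $1$ is a one-element (final) set, $\uplus$ is disjoint union, and $\mathcal{P}$ is the covariant power set functor. An object of $\mathbf{Coalg}_{F_1}$ (a graph with nested hyperedges) is a pair of sets $(V,E)$ together with the unique map $V\to1$ and a function $c:E\to\mathcal{P}(V\uplus E)$ assigning neighbours (nodes or edges) to edges; morphisms $(f_V,f_E):(V_1,E_1,c_1)\to(V_2,E_2,c_2)$ are pairs of functions with $\mathcal{P}(f_V\uplus f_E)\circ c_1=c_2\circ f_E$. For a category $\mathcal{C}$ and class $\mathcal{M}$ of monomorphisms, $(\mathcal{C},\mathcal{M})$ is $\mathcal{M}$-adhesive if $\mathcal{M}$ contains all identities and is closed under composition; pushouts and pullbacks along $\mathcal{M}$-morphisms exist and $\mathcal{M}$ is stable under both; and pushouts along $\mathcal{M}$-morphisms are vertical weak van Kampen squares (for every commutative cube with such a pushout as bottom face, all vertical morphisms in $\mathcal{M}$ and back faces pullbacks, the top face is a pushout iff the front faces are pullbacks). -}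

module Defs where

open import Level using (Level; 0ℓ; _⊔_) renaming (suc to lsuc)
open import Relation.Binary.Bundles using (Setoid)
open import Function.Bundles using (Func)
open import Function.Definitions using (Injective)
open import Data.Sum using (_⊎_; inj₁; inj₂)
open import Data.Sum.Relation.Binary.Pointwise using (_⊎ₛ_; inj₁; inj₂)
open import Data.Product using (Σ; Σ-syntax; _×_; _,_; proj₁; proj₂)

record Category (o h e : Level) : Set (lsuc (o ⊔ h ⊔ e)) where
  infix  4 _≈_
  infixr 9 _∘_
  field
    Obj  : Set o
    Hom  : Obj → Obj → Set h
    _≈_  : ∀ {A B} → Hom A B → Hom A B → Set e
    id   : ∀ {A} → Hom A A
    _∘_  : ∀ {A B C} → Hom B C → Hom A B → Hom A C
    ≈-refl  : ∀ {A B} {f : Hom A B} → f ≈ f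
    ≈-sym   : ∀ {A B} {f g : Hom A B} → f ≈ g → g ≈ f
    ≈-trans : ∀ {A B} {f g k : Hom A B} → f ≈ g → g ≈ k → f ≈ k
    ∘-resp-≈ : ∀ {A B C} {f f' : Hom B C} {g g' : Hom A B} →
               f ≈ f' → g ≈ g' → f ∘ g ≈ f' ∘ g'
    assoc     : ∀ {A B C D} {f : Hom A B} {g : Hom B C} {k : Hom C D} →
                (k ∘ g) ∘ f ≈ k ∘ (g ∘ f)
    identityˡ : ∀ {A B} {f : Hom A B} → id ∘ f ≈ f
    identityʳ : ∀ {A B} {f : Hom A B} → f ∘ id ≈ f

module CatNotions {o h e : Level} (C : Category o h e) where
  open Category C

  Mono : ∀ {A B} → Hom A B → Set (o ⊔ h ⊔ e)
  Mono {A} f = ∀ {X} (g k : Hom X A) → f ∘ g ≈ f ∘ k → g ≈ k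

  record IsPushout {A B C D : Obj} (f : Hom A B) (g : Hom A C)
                   (i₁ : Hom B D) (i₂ : Hom C D) : Set (o ⊔ h ⊔ e) where
    field
      commute   : i₁ ∘ f ≈ i₂ ∘ g
      universal : ∀ {X} (p : Hom B X) (q : Hom C X) → p ∘ f ≈ q ∘ g →
                  Σ[ u ∈ Hom D X ]
                    ((u ∘ i₁ ≈ p) × (u ∘ i₂ ≈ q) ×
                     (∀ (u' : Hom D X) → u' ∘ i₁ ≈ p → u' ∘ i₂ ≈ q → u' ≈ u))

  record IsPullback {P B C D : Obj} (p₁ : Hom P B) (p₂ : Hom P C)
                    (f : Hom B D) (g : Hom C D) : Set (o ⊔ h ⊔ e) where
    field
      commute   : f ∘ p₁ ≈ g ∘ p₂
      universal : ∀ {X} (q₁ : Hom X B) (q₂ : Hom X C) → f ∘ q₁ ≈ g ∘ q₂ →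
                  Σ[ u ∈ Hom X P ]
                    ((p₁ ∘ u ≈ q₁) × (p₂ ∘ u ≈ q₂) ×
                     (∀ (u' : Hom X P) → p₁ ∘ u' ≈ q₁ → p₂ ∘ u' ≈ q₂ → u' ≈ u))

  record MAdhesive {m : Level} (M : ∀ {A B} → Hom A B → Set m)
         : Set (o ⊔ h ⊔ e ⊔ m) where
    field
      M-mono   : ∀ {A B} {f : Hom A B} → M f → Mono f
      M-id     : ∀ {A} → M (id {A})
      M-∘      : ∀ {A B C} {f : Hom A B} {g : Hom B C} → M f → M g → M (g ∘ f)
      pushout-along-M : ∀ {A B C} (m : Hom A B) (g : Hom A C) → M m →
                        Σ[ D ∈ Obj ] Σ[ i₁ ∈ Hom B D ] Σ[ i₂ ∈ Hom C D ]
                          IsPushout m g i₁ i₂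
      pushout-stable  : ∀ {A B C D} {m : Hom A B} {g : Hom A C}
                          {i₁ : Hom B D} {i₂ : Hom C D} →
                        IsPushout m g i₁ i₂ → M m → M i₂
      pullback-along-M : ∀ {B C D} (f : Hom B D) (m : Hom C D) → M m →
                         Σ[ P ∈ Obj ] Σ[ p₁ ∈ Hom P B ] Σ[ p₂ ∈ Hom P C ]
                           IsPullback p₁ p₂ f m
      pullback-stable  : ∀ {P B C D} {p₁ : Hom P B} {p₂ : Hom P C}
                           {f : Hom B D} {m : Hom C D} →
                         IsPullback p₁ p₂ f m → M m → M p₁
      vertical-weak-VK :
        ∀ {A B C D A' B' C' D'}
          {m : Hom A B} {n : Hom A C} {g : Hom B D} {k : Hom C D}
          {m' : Hom A' B'} {n' : Hom A' C'} {g' : Hom B' D'} {k' : Hom C' D'}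
          {a : Hom A' A} {b : Hom B' B} {c : Hom C' C} {d : Hom D' D} →
        M m → IsPushout m n g k →
        g' ∘ m' ≈ k' ∘ n' →
        b ∘ m' ≈ m ∘ a → c ∘ n' ≈ n ∘ a →
        d ∘ g' ≈ g ∘ b → d ∘ k' ≈ k ∘ c →
        M a → M b → M c → M d →
        IsPullback m' a b m → IsPullback n' a c n →
        (IsPushout m' n' g' k' →
           IsPullback g' b d g × IsPullback k' c d k) ×
        (IsPullback g' b d g × IsPullback k' c d k →
           IsPushout m' n' g' k')

SetS : Set₁
SetS = Setoid 0ℓ 0ℓ

module _ {A B : SetS} where
  open Func
  private
    module A = Setoid A
    module B = Setoid B

  _≗F_ : Func A B → Func A B → Set
  f ≗F g = ∀ (x : A.Carrier) → to f x B.≈ to g x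

record Subset (A : SetS) : Set₁ where
  open Setoid A
  field
    mem  : Carrier → Set
    resp : ∀ {x y} → x ≈ y → mem x → mem y
open Subset public

_≐_ : ∀ {A : SetS} → Subset A → Subset A → Set
_≐_ {A} S T = ∀ (x : Setoid.Carrier A) → (mem S x → mem T x) × (mem T x → mem S x)

-- covariant power set functor on morphisms: direct image
image : ∀ {A B : SetS} → Func A B → Subset A → Subset B
image {A} {B} f S = record
  { mem  = λ y → Σ[ x ∈ Setoid.Carrier A ] (mem S x × (Func.to f x ≈ y))
  ; resp = λ { y≈y' (x , sx , fx≈y) → x , sx , trans fx≈y y≈y' } }
  where open Setoid B

_⊎F_ : ∀ {A B C D : SetS} → Func A B → Func C D → Func (A ⊎ₛ C) (B ⊎ₛ D)
_⊎F_ f g = record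
  { to   = λ { (inj₁ x) → inj₁ (Func.to f x) ; (inj₂ y) → inj₂ (Func.to g y) }
  ; cong = λ { (inj₁ p) → inj₁ (Func.cong f p) ; (inj₂ p) → inj₂ (Func.cong g p) } }

-- Objects of Coalg_{F₁}: graphs with nested hyperedges (V , E , c : E → P(V ⊎ E)).
-- (The V-component V → 1 is unique and therefore omitted.)
record Graph : Set₁ where
  field
    V E  : SetS
    c    : Setoid.Carrier E → Subset (V ⊎ₛ E)
    c-cong : ∀ {e e'} → Setoid._≈_ E e e' → c e ≐ c e'
open Graph public

record GHom (G H : Graph) : Set₁ where
  field
    fV : Func (V G) (V H)
    fE : Func (E G) (E H)
    comm : ∀ (e : Setoid.Carrier (E G)) →
           image (fV ⊎F fE) (c G e) ≐ c H (Func.to fE e)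
open GHom public

_≈G_ : ∀ {G H} → GHom G H → GHom G H → Set
f ≈G g = (fV f ≗F fV g) × (fE f ≗F fE g)

M₁ : ∀ {G H} → GHom G H → Set
M₁ {G} {H} f =
  Injective (Setoid._≈_ (V G)) (Setoid._≈_ (V H)) (Func.to (fV f)) ×
  Injective (Setoid._≈_ (E G)) (Setoid._≈_ (E H)) (Func.to (fE f))

idF : ∀ {A : SetS} → Func A A
idF = record { to = λ x → x ; cong = λ p → p }

_∘F_ : ∀ {A B C : SetS} → Func B C → Func A B → Func A C
g ∘F f = record { to = λ x → Func.to g (Func.to f x)
                ; cong = λ p → Func.cong g (Func.cong f p) }

module _ {A : SetS} where
  ≐-refl : {S : Subset A} → S ≐ S
  ≐-refl x = (λ s → s) , (λ s → s)

  ≐-sym : {S T : Subset A} → S ≐ T → T ≐ S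
  ≐-sym p x = proj₂ (p x) , proj₁ (p x)

  ≐-trans : {S T U : Subset A} → S ≐ T → T ≐ U → S ≐ U
  ≐-trans p q x = (λ s → proj₁ (q x) (proj₁ (p x) s)) ,
                  (λ u → proj₂ (p x) (proj₂ (q x) u))

image-cong : ∀ {A B : SetS} (f : Func A B) {S T : Subset A} → S ≐ T →
             image f S ≐ image f T
image-cong f p y = (λ { (x , s , e) → x , proj₁ (p x) s , e }) ,
                   (λ { (x , t , e) → x , proj₂ (p x) t , e })

image-id : ∀ {A : SetS} (h : Func A A) → (∀ x → Setoid._≈_ A (Func.to h x) x) →
           (S : Subset A) → image h S ≐ S
image-id {A} h hid S y =
  (λ { (x , s , e) → resp S (trans (sym (hid x)) e) s }) ,
  (λ s → y , s , hid y)
  where open Setoid A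

image-comp : ∀ {A B C : SetS} (g : Func B C) (f : Func A B) (h : Func A C) →
             (∀ x → Setoid._≈_ C (Func.to h x) (Func.to g (Func.to f x))) →
             (S : Subset A) → image h S ≐ image g (image f S)
image-comp {A} {B} {C} g f h hp S z =
  (λ { (x , s , e) → Func.to f x , (x , s , Setoid.refl B) ,
                     Setoid.trans C (Setoid.sym C (hp x)) e }) ,
  (λ { (y , (x , s , e₁) , e₂) → x , s ,
        Setoid.trans C (hp x) (Setoid.trans C (Func.cong g e₁) e₂) })

idG : ∀ {G : Graph} → GHom G G
idG {G} = record
  { fV = idF ; fE = idF
  ; comm = λ e → image-id (idF ⊎F idF) pw (c G e) }
  where
    open Setoid (V G ⊎ₛ E G)
    pw : ∀ x → Func.to (idF {V G} ⊎F idF {E G}) x ≈ x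
    pw (inj₁ x) = refl
    pw (inj₂ y) = refl

_∘G_ : ∀ {G H K : Graph} → GHom H K → GHom G H → GHom G K
_∘G_ {G} {H} {K} g f = record
  { fV = fV g ∘F fV f
  ; fE = fE g ∘F fE f
  ; comm = cm }
  where
    open Setoid (V K ⊎ₛ E K)
    pw : ∀ x → Func.to ((fV g ∘F fV f) ⊎F (fE g ∘F fE f)) x ≈
               Func.to (fV g ⊎F fE g) (Func.to (fV f ⊎F fE f) x)
    pw (inj₁ x) = refl
    pw (inj₂ y) = refl
    hV = fV g ∘F fV f
    hE = fE g ∘F fE f
    cm : ∀ e → image (hV ⊎F hE) (c G e) ≐ c K (Func.to hE e)
    cm e = ≐-trans {V K ⊎ₛ E K} {image (hV ⊎F hE) (c G e)}
             {image (fV g ⊎F fE g) (image (fV f ⊎F fE f) (c G e))}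
             {c K (Func.to hE e)}
             (image-comp (fV g ⊎F fE g) (fV f ⊎F fE f) (hV ⊎F hE) pw (c G e))
             (≐-trans {V K ⊎ₛ E K}
               {image (fV g ⊎F fE g) (image (fV f ⊎F fE f) (c G e))}
               {image (fV g ⊎F fE g) (c H (Func.to (fE f) e))}
               {c K (Func.to hE e)}
               (image-cong (fV g ⊎F fE g) {image (fV f ⊎F fE f) (c G e)} {c H (Func.to (fE f) e)} (comm f e))
               (comm g (Func.to (fE f) e)))

CoalgF₁ : Category (lsuc 0ℓ) (lsuc 0ℓ) 0ℓ
CoalgF₁ = record
  { Obj = Graph
  ; Hom = GHom
  ; _≈_ = _≈G_
  ; id = idG
  ; _∘_ = _∘G_
  ; ≈-refl = λ {A} {B} → (λ x → Setoid.refl (V B)) , (λ x → Setoid.refl (E B))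
  ; ≈-sym = λ {A} {B} (p , q) → (λ x → Setoid.sym (V B) (p x)) ,
                                (λ x → Setoid.sym (E B) (q x))
  ; ≈-trans = λ {A} {B} (p , q) (p' , q') →
                (λ x → Setoid.trans (V B) (p x) (p' x)) ,
                (λ x → Setoid.trans (E B) (q x) (q' x))
  ; ∘-resp-≈ = λ {A} {B} {C} {f} {f'} {g} {g'} (p , q) (p' , q') →
                 (λ x → Setoid.trans (V C) (Func.cong (fV f) (p' x)) (p (Func.to (fV g') x))) ,
                 (λ x → Setoid.trans (E C) (Func.cong (fE f) (q' x)) (q (Func.to (fE g') x)))
  ; assoc = λ {A} {B} {C} {D} → (λ x → Setoid.refl (V D)) , (λ x → Setoid.refl (E D))
  ; identityˡ = λ {A} {B} → (λ x → Setoid.refl (V B)) , (λ x → Setoid.refl (E B))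
  ; identityʳ = λ {A} {B} → (λ x → Setoid.refl (V B)) , (λ x → Setoid.refl (E B))
  }

module Submission where

-- For graphs, a square (with the relevant leg in M) is a pullback, resp.
-- pushout, exactly when both of its components are ('PullbackFromComponents',
-- 'PullbackToComponents' and the pushout analogues; the second direction
-- compares with the canonical construction).

open import Level using (Level; 0ℓ) renaming (suc to lsuc)
open import Axiom.ExcludedMiddle using (ExcludedMiddle)
open import Defs
open import Relation.Binary.Bundles using (Setoid)
open import Function.Bundles using (Func)
open import Function.Definitions using (Injective)
open import Data.Sum using (_⊎_; inj₁; inj₂; [_,_]; map)
open import Data.Sum.Relation.Binary.Pointwise using (_⊎ₛ_; inj₁; inj₂)
open import Data.Product using (Σ; Σ-syntax; _×_; _,_; proj₁; proj₂)
import Relation.Binary.Reasoning.Setoid as SetoidReasoning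

open Func

Car : SetS → Set
Car = Setoid.Carrier

Inj : {A B : SetS} → Func A B → Set
Inj {A} {B} f = Injective (Setoid._≈_ A) (Setoid._≈_ B) (to f)

SubsetSetoid : SetS → Setoid (lsuc 0ℓ) 0ℓ
SubsetSetoid A = record
  { Carrier = Subset A
  ; _≈_ = _≐_
  ; isEquivalence = record
      { refl = λ {S} → ≐-refl {A} {S}
      ; sym = λ {S} {T} → ≐-sym {A} {S} {T}
      ; trans = λ {S} {T} {U} → ≐-trans {A} {S} {T} {U} } }

image-ext : ∀ {A B : SetS} {f f' : Func A B} → f ≗F f' → (S : Subset A) →
            image f S ≐ image f' S
image-ext {B = B} p S y =
  (λ { (x , s , e) → x , s , Setoid.trans B (Setoid.sym B (p x)) e }) ,
  (λ { (x , s , e) → x , s , Setoid.trans B (p x) e })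

image-∘ : ∀ {A B C : SetS} (g : Func B C) (f : Func A B) (S : Subset A) →
          image g (image f S) ≐ image (g ∘F f) S
image-∘ {C = C} g f S =
  ≐-sym {C} {image (g ∘F f) S} {image g (image f S)}
        (image-comp g f (g ∘F f) (λ x → Setoid.refl C) S)

module _ {A B C D : SetS} where
  ⊎-inj : {f : Func A B} {g : Func C D} → Inj f → Inj g → Inj (f ⊎F g)
  ⊎-inj fi gi {inj₁ x} {inj₁ y} (inj₁ e) = inj₁ (fi e)
  ⊎-inj fi gi {inj₂ x} {inj₂ y} (inj₂ e) = inj₂ (gi e)

module _ {A B C A' B' C' : SetS} where
  ⊎-square : {h₁ : Func B C} {u₁ : Func A B} {q₁ : Func A C}
             {h₂ : Func B' C'} {u₂ : Func A' B'} {q₂ : Func A' C'} →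
             (∀ x → Setoid._≈_ C (to h₁ (to u₁ x)) (to q₁ x)) →
             (∀ x → Setoid._≈_ C' (to h₂ (to u₂ x)) (to q₂ x)) →
             ∀ z → Setoid._≈_ (C ⊎ₛ C') (to (h₁ ⊎F h₂) (to (u₁ ⊎F u₂) z))
                                         (to (q₁ ⊎F q₂) z)
  ⊎-square p q (inj₁ x) = inj₁ (p x)
  ⊎-square p q (inj₂ y) = inj₂ (q y)

record SetPullback {P B C D : SetS} (p₁ : Func P B) (p₂ : Func P C)
                   (f : Func B D) (m : Func C D) : Set where
  field
    jointly-injective : ∀ {x y} → Setoid._≈_ B (to p₁ x) (to p₁ y) →
                        Setoid._≈_ C (to p₂ x) (to p₂ y) → Setoid._≈_ P x y
    lift-pair : ∀ {b c} → Setoid._≈_ D (to f b) (to m c) →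
                Σ[ x ∈ Car P ] (Setoid._≈_ B (to p₁ x) b × Setoid._≈_ C (to p₂ x) c)
open SetPullback public

module _ {P B C D : SetS} {p₁ : Func P B} {p₂ : Func P C}
         {f : Func B D} {m : Func C D} where
  private
    module B = Setoid B
    module C = Setoid C
    module D = Setoid D

  SetPullback-swap : SetPullback p₁ p₂ f m → SetPullback p₂ p₁ m f
  SetPullback-swap pb = record
    { jointly-injective = λ e₁ e₂ → jointly-injective pb e₂ e₁
    ; lift-pair = λ e → let (x , e₁ , e₂) = lift-pair pb (D.sym e) in x , e₂ , e₁ }

  SetPullback-inj : SetPullback p₁ p₂ f m →
                    (∀ x → to f (to p₁ x) D.≈ to m (to p₂ x)) → Inj m → Inj p₁
  SetPullback-inj pb commute mi {x} {y} e = jointly-injective pb e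
    (mi (D.trans (D.sym (commute x)) (D.trans (cong f e) (commute y))))

  -- The mediating map into a pullback (its uniqueness is joint injectivity).
  SetPullback-mediator :
    SetPullback p₁ p₂ f m → {X : SetS} (q₁ : Func X B) (q₂ : Func X C) →
    (∀ x → to f (to q₁ x) D.≈ to m (to q₂ x)) →
    Σ[ u ∈ Func X P ] ((∀ x → to p₁ (to u x) B.≈ to q₁ x) ×
                       (∀ x → to p₂ (to u x) C.≈ to q₂ x))
  SetPullback-mediator pb q₁ q₂ qe =
    record { to = λ x → proj₁ (lifted x)
           ; cong = λ {x} {y} e →
               jointly-injective pb
                 (B.trans (over-q₁ x) (B.trans (cong q₁ e) (B.sym (over-q₁ y))))
                 (C.trans (over-q₂ x) (C.trans (cong q₂ e) (C.sym (over-q₂ y)))) } ,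
    over-q₁ , over-q₂
    where
      lifted : ∀ x → Σ[ y ∈ Car P ] (to p₁ y B.≈ to q₁ x × to p₂ y C.≈ to q₂ x)
      lifted x = lift-pair pb (qe x)
      over-q₁ : ∀ x → to p₁ (proj₁ (lifted x)) B.≈ to q₁ x
      over-q₁ x = proj₁ (proj₂ (lifted x))
      over-q₂ : ∀ x → to p₂ (proj₁ (lifted x)) C.≈ to q₂ x
      over-q₂ x = proj₂ (proj₂ (lifted x))

module _ {P B C D P' B' C' D' : SetS}
         {p₁ : Func P B} {p₂ : Func P C} {f : Func B D} {m : Func C D}
         {p₁' : Func P' B'} {p₂' : Func P' C'} {f' : Func B' D'} {m' : Func C' D'} where
  ⊎-SetPullback : SetPullback p₁ p₂ f m → SetPullback p₁' p₂' f' m' →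
                  SetPullback (p₁ ⊎F p₁') (p₂ ⊎F p₂') (f ⊎F f') (m ⊎F m')
  ⊎-SetPullback pb pb' = record { jointly-injective = injective ; lift-pair = lift }
    where
      injective : ∀ {x y} →
                  Setoid._≈_ (B ⊎ₛ B') (to (p₁ ⊎F p₁') x) (to (p₁ ⊎F p₁') y) →
                  Setoid._≈_ (C ⊎ₛ C') (to (p₂ ⊎F p₂') x) (to (p₂ ⊎F p₂') y) →
                  Setoid._≈_ (P ⊎ₛ P') x y
      injective {inj₁ x} {inj₁ y} (inj₁ e₁) (inj₁ e₂) =
        inj₁ (jointly-injective pb e₁ e₂)
      injective {inj₂ x} {inj₂ y} (inj₂ e₁) (inj₂ e₂) =
        inj₂ (jointly-injective pb' e₁ e₂)
      lift : ∀ {b c} → Setoid._≈_ (D ⊎ₛ D') (to (f ⊎F f') b) (to (m ⊎F m') c) →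
             Σ[ x ∈ Car (P ⊎ₛ P') ] (Setoid._≈_ (B ⊎ₛ B') (to (p₁ ⊎F p₁') x) b ×
                                     Setoid._≈_ (C ⊎ₛ C') (to (p₂ ⊎F p₂') x) c)
      lift {inj₁ b} {inj₁ c} (inj₁ e) = let (x , e₁ , e₂) = lift-pair pb e in
                                        inj₁ x , inj₁ e₁ , inj₁ e₂
      lift {inj₂ b} {inj₂ c} (inj₂ e) = let (x , e₁ , e₂) = lift-pair pb' e in
                                        inj₂ x , inj₂ e₁ , inj₂ e₂

module _ {P P₀ B C D : SetS} {p₁ : Func P B} {p₂ : Func P C}
         {q₁ : Func P₀ B} {q₂ : Func P₀ C} {f : Func B D} {m : Func C D} where
  private
    module P = Setoid P
    module B = Setoid B
    module C = Setoid C

  SetPullback-transfer :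
    SetPullback q₁ q₂ f m →
    (v : Func P P₀) → (q₁ ∘F v) ≗F p₁ → (q₂ ∘F v) ≗F p₂ →
    (u : Func P₀ P) → (p₁ ∘F u) ≗F q₁ → (p₂ ∘F u) ≗F q₂ →
    (u ∘F v) ≗F idF → SetPullback p₁ p₂ f m
  SetPullback-transfer pb v v₁ v₂ u u₁ u₂ uv≈id = record
    { jointly-injective = λ {x} {y} e₁ e₂ →
        let vx≈vy = jointly-injective pb (B.trans (v₁ x) (B.trans e₁ (B.sym (v₁ y))))
                                         (C.trans (v₂ x) (C.trans e₂ (C.sym (v₂ y))))
        in P.trans (P.sym (uv≈id x)) (P.trans (cong u vx≈vy) (uv≈id y))
    ; lift-pair = λ e → let (y , e₁ , e₂) = lift-pair pb e in
        to u y , B.trans (u₁ y) e₁ , C.trans (u₂ y) e₂ }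

module _ {B C D : SetS} (f : Func B D) (m : Func C D) where
  private
    module B = Setoid B
    module C = Setoid C
    module D = Setoid D

  PullbackSetoid : SetS
  PullbackSetoid = record
    { Carrier = Σ[ bc ∈ Car B × Car C ] (to f (proj₁ bc) D.≈ to m (proj₂ bc))
    ; _≈_ = λ x y → (proj₁ (proj₁ x) B.≈ proj₁ (proj₁ y)) ×
                    (proj₂ (proj₁ x) C.≈ proj₂ (proj₁ y))
    ; isEquivalence = record
        { refl = B.refl , C.refl
        ; sym = λ (p , q) → B.sym p , C.sym q
        ; trans = λ (p , q) (p' , q') → B.trans p p' , C.trans q q' } }

  π₁ : Func PullbackSetoid B
  π₁ = record { to = λ x → proj₁ (proj₁ x) ; cong = proj₁ }

  π₂ : Func PullbackSetoid C
  π₂ = record { to = λ x → proj₂ (proj₁ x) ; cong = proj₂ }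

  PullbackSetoid-isPullback : SetPullback π₁ π₂ f m
  PullbackSetoid-isPullback = record
    { jointly-injective = _,_
    ; lift-pair = λ {b} {c} e → ((b , c) , e) , B.refl , C.refl }

-- Pushouts of setoids of a span B ←m− A −n→ C; the explicit description of
-- the gluing below is correct when m is injective.
module Gluing {A B C : SetS} (m : Func A B) (n : Func A C) where
  private
    module B = Setoid B
    module C = Setoid C

  -- Two elements of B are
  -- glued when they are equal or both come through m from points with equal
  -- images under n; for injective m this relation is already transitive.
  Glued : Car B ⊎ Car C → Car B ⊎ Car C → Set
  Glued (inj₁ b) (inj₁ b') = (b B.≈ b') ⊎
    (Σ[ a ∈ Car A ] Σ[ a' ∈ Car A ] (to m a B.≈ b × to m a' B.≈ b' × to n a C.≈ to n a'))
  Glued (inj₁ b) (inj₂ c) = Σ[ a ∈ Car A ] (to m a B.≈ b × to n a C.≈ c)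
  Glued (inj₂ c) (inj₁ b) = Σ[ a ∈ Car A ] (to m a B.≈ b × to n a C.≈ c)
  Glued (inj₂ c) (inj₂ c') = c C.≈ c'

  copair : {D : SetS} → Func B D → Func C D → Car B ⊎ Car C → Car D
  copair g k = [ to g , to k ]

  record SetPushout {D : SetS} (g : Func B D) (k : Func C D) : Set where
    field
      jointly-surjective : ∀ d → Σ[ x ∈ Car B ⊎ Car C ] (Setoid._≈_ D (copair g k x) d)
      glued-kernel : ∀ x y → Setoid._≈_ D (copair g k x) (copair g k y) → Glued x y
  open SetPushout public

  SetPushout-inj : {D : SetS} {g : Func B D} {k : Func C D} → SetPushout g k → Inj k
  SetPushout-inj po {x} {y} = glued-kernel po (inj₂ x) (inj₂ y)

  module _ {X : SetS} (p : Func B X) (q : Func C X)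
           (pq : ∀ a → Setoid._≈_ X (to p (to m a)) (to q (to n a))) where
    private module X = Setoid X

    copair-respects-Glued : ∀ x y → Glued x y → copair p q x X.≈ copair p q y
    copair-respects-Glued (inj₁ b) (inj₁ b') (inj₁ e) = cong p e
    copair-respects-Glued (inj₁ b) (inj₁ b') (inj₂ (a , a' , e₁ , e₂ , e₃)) =
      X.trans (cong p (B.sym e₁)) (X.trans (pq a) (X.trans (cong q e₃)
        (X.trans (X.sym (pq a')) (cong p e₂))))
    copair-respects-Glued (inj₁ b) (inj₂ c) (a , e₁ , e₂) =
      X.trans (cong p (B.sym e₁)) (X.trans (pq a) (cong q e₂))
    copair-respects-Glued (inj₂ c) (inj₁ b) (a , e₁ , e₂) =
      X.trans (cong q (C.sym e₂)) (X.trans (X.sym (pq a)) (cong p e₁))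
    copair-respects-Glued (inj₂ c) (inj₂ c') e = cong q e

  copair-∘ : {D X : SetS} {g : Func B D} {k : Func C D} {p : Func B X} {q : Func C X}
             (φ : Func D X) → (φ ∘F g) ≗F p → (φ ∘F k) ≗F q →
             ∀ x → Setoid._≈_ X (to φ (copair g k x)) (copair p q x)
  copair-∘ φ φg φk (inj₁ b) = φg b
  copair-∘ φ φg φk (inj₂ c) = φk c

  -- The mediating map out of a pushout: choose a preimage and apply p or q;
  -- well defined because p and q respect the gluing.
  module SetPushoutMediator {D : SetS} {g : Func B D} {k : Func C D} (po : SetPushout g k)
           {X : SetS} (p : Func B X) (q : Func C X)
           (pq : ∀ a → Setoid._≈_ X (to p (to m a)) (to q (to n a))) where
    private
      module X = Setoid X
      module D = Setoid D
      preimage : Car D → Car B ⊎ Car C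
      preimage d = proj₁ (jointly-surjective po d)
      preimage≈ : ∀ d → copair g k (preimage d) D.≈ d
      preimage≈ d = proj₂ (jointly-surjective po d)
      respects : ∀ x y → Glued x y → copair p q x X.≈ copair p q y
      respects = copair-respects-Glued p q pq

    mediator : Func D X
    mediator = record
      { to = λ d → copair p q (preimage d)
      ; cong = λ {d} {d'} e → respects (preimage d) (preimage d')
          (glued-kernel po (preimage d) (preimage d')
            (D.trans (preimage≈ d) (D.trans e (D.sym (preimage≈ d'))))) }

    mediator-g : ∀ b → to mediator (to g b) X.≈ to p b
    mediator-g b = respects (preimage (to g b)) (inj₁ b)
      (glued-kernel po (preimage (to g b)) (inj₁ b) (preimage≈ (to g b)))

    mediator-k : ∀ c → to mediator (to k c) X.≈ to q c
    mediator-k c = respects (preimage (to k c)) (inj₂ c)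
      (glued-kernel po (preimage (to k c)) (inj₂ c) (preimage≈ (to k c)))

    mediator-unique : (u : Func D X) → (∀ b → to u (to g b) X.≈ to p b) →
                      (∀ c → to u (to k c) X.≈ to q c) → ∀ d → to u d X.≈ to mediator d
    mediator-unique u ug uk d =
      X.trans (cong u (D.sym (preimage≈ d)))
              (copair-∘ {g = g} {k = k} {p = p} {q = q} u ug uk (preimage d))

  module _ {D D₀ : SetS} {g : Func B D} {k : Func C D}
           {ι₁ : Func B D₀} {ι₂ : Func C D₀} where
    private
      module D = Setoid D
      module D₀ = Setoid D₀

    SetPushout-transfer :
      SetPushout ι₁ ι₂ →
      (u : Func D D₀) → (u ∘F g) ≗F ι₁ → (u ∘F k) ≗F ι₂ →
      (v : Func D₀ D) → (v ∘F ι₁) ≗F g → (v ∘F ι₂) ≗F k →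
      (v ∘F u) ≗F idF → SetPushout g k
    SetPushout-transfer po u ug uk v vι₁ vι₂ vu≈id = record
      { jointly-surjective = λ d →
          let (x , hx) = jointly-surjective po (to u d) in
          x , D.trans (D.sym (v-copair x)) (D.trans (cong v hx) (vu≈id d))
      ; glued-kernel = λ x y e → glued-kernel po x y
          (D₀.trans (D₀.sym (u-copair x)) (D₀.trans (cong u e) (u-copair y))) }
      where
        v-copair : ∀ x → to v (copair ι₁ ι₂ x) D.≈ copair g k x
        v-copair = copair-∘ {g = ι₁} {k = ι₂} {p = g} {q = k} v vι₁ vι₂
        u-copair : ∀ x → to u (copair g k x) D₀.≈ copair ι₁ ι₂ x
        u-copair = copair-∘ {g = g} {k = k} {p = ι₁} {q = ι₂} u ug uk

  module CanonicalPushout (mi : Inj m) where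
    Glued-refl : ∀ x → Glued x x
    Glued-refl (inj₁ b) = inj₁ B.refl
    Glued-refl (inj₂ c) = C.refl

    Glued-sym : ∀ x y → Glued x y → Glued y x
    Glued-sym (inj₁ b) (inj₁ b') (inj₁ e) = inj₁ (B.sym e)
    Glued-sym (inj₁ b) (inj₁ b') (inj₂ (a , a' , e₁ , e₂ , e₃)) =
      inj₂ (a' , a , e₂ , e₁ , C.sym e₃)
    Glued-sym (inj₁ b) (inj₂ c) r = r
    Glued-sym (inj₂ c) (inj₁ b) r = r
    Glued-sym (inj₂ c) (inj₂ c') e = C.sym e

    -- Transitivity is where injectivity of m is used: two gluing witnesses
    -- over the same element of B are equal, hence have equal n-images.
    same-witness : ∀ {a a' b} → to m a B.≈ b → to m a' B.≈ b → to n a C.≈ to n a'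
    same-witness e e' = cong n (mi (B.trans e (B.sym e')))

    Glued-trans : ∀ x y z → Glued x y → Glued y z → Glued x z
    Glued-trans (inj₁ b) (inj₁ b') (inj₁ b'') (inj₁ e) (inj₁ e') = inj₁ (B.trans e e')
    Glued-trans (inj₁ b) (inj₁ b') (inj₁ b'') (inj₁ e) (inj₂ (a , a' , e₁ , e₂ , e₃)) =
      inj₂ (a , a' , B.trans e₁ (B.sym e) , e₂ , e₃)
    Glued-trans (inj₁ b) (inj₁ b') (inj₁ b'') (inj₂ (a , a' , e₁ , e₂ , e₃)) (inj₁ e) =
      inj₂ (a , a' , e₁ , B.trans e₂ e , e₃)
    Glued-trans (inj₁ b) (inj₁ b') (inj₁ b'')
                (inj₂ (a₁ , a₂ , e₁ , e₂ , e₃)) (inj₂ (a₃ , a₄ , f₁ , f₂ , f₃)) =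
      inj₂ (a₁ , a₄ , e₁ , f₂ , C.trans e₃ (C.trans (same-witness e₂ f₁) f₃))
    Glued-trans (inj₁ b) (inj₁ b') (inj₂ c) (inj₁ e) (a , e₁ , e₂) =
      a , B.trans e₁ (B.sym e) , e₂
    Glued-trans (inj₁ b) (inj₁ b') (inj₂ c)
                (inj₂ (a₁ , a₂ , e₁ , e₂ , e₃)) (a , f₁ , f₂) =
      a₁ , e₁ , C.trans e₃ (C.trans (same-witness e₂ f₁) f₂)
    Glued-trans (inj₁ b) (inj₂ c) (inj₁ b'') (a , e₁ , e₂) (a' , f₁ , f₂) =
      inj₂ (a , a' , e₁ , f₁ , C.trans e₂ (C.sym f₂))
    Glued-trans (inj₁ b) (inj₂ c) (inj₂ c') (a , e₁ , e₂) e = a , e₁ , C.trans e₂ e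
    Glued-trans (inj₂ c) (inj₁ b) (inj₁ b'') (a , e₁ , e₂) (inj₁ e) =
      a , B.trans e₁ e , e₂
    Glued-trans (inj₂ c) (inj₁ b) (inj₁ b'')
                (a , e₁ , e₂) (inj₂ (a₁ , a₂ , f₁ , f₂ , f₃)) =
      a₂ , f₂ , C.trans (C.sym f₃) (C.trans (same-witness f₁ e₁) e₂)
    Glued-trans (inj₂ c) (inj₁ b) (inj₂ c') (a , e₁ , e₂) (a' , f₁ , f₂) =
      C.trans (C.sym e₂) (C.trans (same-witness e₁ f₁) f₂)
    Glued-trans (inj₂ c) (inj₂ c') (inj₁ b) e (a , f₁ , f₂) =
      a , f₁ , C.trans f₂ (C.sym e)
    Glued-trans (inj₂ c) (inj₂ c') (inj₂ c'') e e' = C.trans e e'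

    PushoutSetoid : SetS
    PushoutSetoid = record
      { Carrier = Car B ⊎ Car C ; _≈_ = Glued
      ; isEquivalence = record { refl = λ {x} → Glued-refl x
                               ; sym = λ {x} {y} → Glued-sym x y
                               ; trans = λ {x} {y} {z} → Glued-trans x y z } }

    ι₁ : Func B PushoutSetoid
    ι₁ = record { to = inj₁ ; cong = inj₁ }

    ι₂ : Func C PushoutSetoid
    ι₂ = record { to = inj₂ ; cong = λ e → e }

    ι-commute : ∀ a → Glued (inj₁ (to m a)) (inj₂ (to n a))
    ι-commute a = a , B.refl , C.refl

    PushoutSetoid-isPushout : SetPushout ι₁ ι₂
    PushoutSetoid-isPushout = record
      { jointly-surjective = λ x → x , copair-glued x
      ; glued-kernel = λ { (inj₁ b) (inj₁ b') r → r ; (inj₁ b) (inj₂ c) r → r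
                         ; (inj₂ c) (inj₁ b) r → r ; (inj₂ c) (inj₂ c') r → r } }
      where
        copair-glued : ∀ x → Glued (copair ι₁ ι₂ x) x
        copair-glued (inj₁ b) = Glued-refl (inj₁ b)
        copair-glued (inj₂ c) = Glued-refl (inj₂ c)

open Gluing using (Glued; copair; SetPushout; jointly-surjective; glued-kernel; SetPushout-inj)

module VanKampenSets {A B C D A' B' C' D' : SetS}
  {m : Func A B} {n : Func A C} {g : Func B D} {k : Func C D}
  {m' : Func A' B'} {n' : Func A' C'} {g' : Func B' D'} {k' : Func C' D'}
  {a : Func A' A} {b : Func B' B} {c : Func C' C} {d : Func D' D}
  (top : ∀ x → Setoid._≈_ D' (to g' (to m' x)) (to k' (to n' x)))
  (back₁ : ∀ x → Setoid._≈_ B (to b (to m' x)) (to m (to a x)))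
  (back₂ : ∀ x → Setoid._≈_ C (to c (to n' x)) (to n (to a x)))
  (front₁ : ∀ x → Setoid._≈_ D (to d (to g' x)) (to g (to b x)))
  (front₂ : ∀ x → Setoid._≈_ D (to d (to k' x)) (to k (to c x)))
  (b-inj : Inj b) (c-inj : Inj c)
  (bottom : SetPushout m n g k)
  (back₁-pb : SetPullback m' a b m) (back₂-pb : SetPullback n' a c n) where
  private
    module B = Setoid B
    module C = Setoid C
    module D = Setoid D
    module B' = Setoid B'
    module D' = Setoid D'

    witness-up : ∀ {x a₀} → to m a₀ B.≈ to b x →
                 Σ[ a' ∈ Car A' ] (to m' a' B'.≈ x × to c (to n' a') C.≈ to n a₀)
    witness-up e = let (a' , f₁ , f₂) = lift-pair back₁-pb (B.sym e) in
                   a' , f₁ , C.trans (back₂ a') (cong n f₂)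

    down : Car B' ⊎ Car C' → Car B ⊎ Car C
    down = map (to b) (to c)

    d-copair : ∀ z → to d (copair m' n' g' k' z) D.≈ copair m n g k (down z)
    d-copair (inj₁ x) = front₁ x
    d-copair (inj₂ y) = front₂ y

    glued-below : ∀ z {x'} w → copair m' n' g' k' z D'.≈ x' →
                  to d x' D.≈ copair m n g k w → Glued m n (down z) w
    glued-below z w e e' = glued-kernel bottom (down z) w
      (D.trans (D.sym (d-copair z)) (D.trans (cong d e) e'))

  -- If the top face is a pushout, every element of D' over g y lies in the
  -- image of g' over y: an element over both sides of the bottom gluing
  -- is brought up to the top through the back pullbacks.
  front₁-pullback : SetPushout m' n' g' k' → SetPullback g' b d g
  front₁-pullback top-po = record
    { jointly-injective = λ _ e → b-inj e
    ; lift-pair = λ {x'} e → lift-from e (proj₁ (jointly-surjective top-po x'))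
                                         (proj₂ (jointly-surjective top-po x')) }
    where
      lift-from : ∀ {x' y} → to d x' D.≈ to g y → (z : Car B' ⊎ Car C') →
                  copair m' n' g' k' z D'.≈ x' →
                  Σ[ b' ∈ Car B' ] (to g' b' D'.≈ x' × to b b' B.≈ y)
      lift-from {x'} {y} e (inj₁ b₁) hb₁
        with glued-below (inj₁ b₁) (inj₁ y) hb₁ e
      ... | inj₁ q = b₁ , hb₁ , q
      ... | inj₂ (a₁ , a₂ , e₁ , e₂ , e₃) =
        let (a₁' , f₁ , f₂) = witness-up e₁
            (a₂' , g₁ , g₂) = lift-pair back₂-pb (C.trans f₂ e₃)
        in to m' a₂' ,
           D'.trans (top a₂') (D'.trans (cong k' g₁) (D'.trans (D'.sym (top a₁'))
             (D'.trans (cong g' f₁) hb₁))) ,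
           B.trans (back₁ a₂') (B.trans (cong m g₂) e₂)
      lift-from {x'} {y} e (inj₂ c₁) hc₁ =
        let (a₀ , e₁ , e₂) = glued-below (inj₂ c₁) (inj₁ y) hc₁ e
            (a' , f₁ , f₂) = lift-pair back₂-pb (C.sym e₂)
        in to m' a' ,
           D'.trans (top a') (D'.trans (cong k' f₁) hc₁) ,
           B.trans (back₁ a') (B.trans (cong m f₂) e₁)

  front₂-pullback : SetPushout m' n' g' k' → SetPullback k' c d k
  front₂-pullback top-po = record
    { jointly-injective = λ _ e → c-inj e
    ; lift-pair = λ {x'} e → lift-from e (proj₁ (jointly-surjective top-po x'))
                                         (proj₂ (jointly-surjective top-po x')) }
    where
      lift-from : ∀ {x' y} → to d x' D.≈ to k y → (z : Car B' ⊎ Car C') →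
                  copair m' n' g' k' z D'.≈ x' →
                  Σ[ c' ∈ Car C' ] (to k' c' D'.≈ x' × to c c' C.≈ y)
      lift-from {x'} {y} e (inj₁ b₁) hb₁ =
        let (a₀ , e₁ , e₂) = glued-below (inj₁ b₁) (inj₂ y) hb₁ e
            (a' , f₁ , f₂) = witness-up e₁
        in to n' a' ,
           D'.trans (D'.sym (top a')) (D'.trans (cong g' f₁) hb₁) ,
           C.trans f₂ e₂
      lift-from {x'} {y} e (inj₂ c₁) hc₁ =
        c₁ , hc₁ , glued-below (inj₂ c₁) (inj₂ y) hc₁ e

  -- Conversely, if the front faces are pullbacks, every element of D' lifts
  -- from a preimage of its d-image, and a gluing of the d-images of two top
  -- elements comes (through the back pullbacks) from a gluing at the top.
  top-pushout : SetPullback g' b d g → SetPullback k' c d k → SetPushout m' n' g' k'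
  top-pushout front₁-pb front₂-pb =
    record { jointly-surjective = surjective ; glued-kernel = kernel }
    where
      surjective-from : ∀ x' → (z : Car B ⊎ Car C) → copair m n g k z D.≈ to d x' →
                        Σ[ z' ∈ Car B' ⊎ Car C' ] (copair m' n' g' k' z' D'.≈ x')
      surjective-from x' (inj₁ y) h =
        let (b' , e , _) = lift-pair front₁-pb (D.sym h) in inj₁ b' , e
      surjective-from x' (inj₂ y) h =
        let (c' , e , _) = lift-pair front₂-pb (D.sym h) in inj₂ c' , e

      surjective : ∀ x' → Σ[ z' ∈ Car B' ⊎ Car C' ] (copair m' n' g' k' z' D'.≈ x')
      surjective x' = surjective-from x' (proj₁ (jointly-surjective bottom (to d x')))
                                         (proj₂ (jointly-surjective bottom (to d x')))

      kernel : ∀ x y → copair m' n' g' k' x D'.≈ copair m' n' g' k' y → Glued m' n' x y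
      kernel (inj₁ x) (inj₁ y) e with glued-below (inj₁ x) (inj₁ (to b y)) e (front₁ y)
      ... | inj₁ q = inj₁ (b-inj q)
      ... | inj₂ (a₁ , a₂ , e₁ , e₂ , e₃) =
        let (a₁' , f₁ , f₂) = witness-up e₁
            (a₂' , g₁ , g₂) = witness-up e₂
        in inj₂ (a₁' , a₂' , f₁ , g₁ , c-inj (C.trans f₂ (C.trans e₃ (C.sym g₂))))
      kernel (inj₁ x) (inj₂ y) e =
        let (a₀ , e₁ , e₂) = glued-below (inj₁ x) (inj₂ (to c y)) e (front₂ y)
            (a' , f₁ , f₂) = witness-up e₁
        in a' , f₁ , c-inj (C.trans f₂ e₂)
      kernel (inj₂ x) (inj₁ y) e =
        let (a₀ , e₁ , e₂) = glued-below (inj₂ x) (inj₁ (to b y)) e (front₁ y)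
            (a' , f₁ , f₂) = witness-up e₁
        in a' , f₁ , c-inj (C.trans f₂ e₂)
      kernel (inj₂ x) (inj₂ y) e =
        c-inj (glued-below (inj₂ x) (inj₂ (to c y)) e (front₂ y))

module _ {o h e : Level} (𝒞 : Category o h e) where
  open Category 𝒞
  open CatNotions 𝒞

  pullback-swap : ∀ {P B C D} {p₁ : Hom P B} {p₂ : Hom P C} {f : Hom B D} {m : Hom C D} →
                  IsPullback p₁ p₂ f m → IsPullback p₂ p₁ m f
  pullback-swap pb = record
    { commute = ≈-sym (IsPullback.commute pb)
    ; universal = λ q₁ q₂ e →
        let (u , e₁ , e₂ , unique) = IsPullback.universal pb q₂ q₁ (≈-sym e)
        in u , e₂ , e₁ , λ u' e₁' e₂' → unique u' e₂' e₁' }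

  pullback-comparison :
    ∀ {P B C D X} {p₁ : Hom P B} {p₂ : Hom P C} {f : Hom B D} {m : Hom C D} →
    IsPullback p₁ p₂ f m → {q₁ : Hom X B} {q₂ : Hom X C} {u : Hom X P} {v : Hom P X} →
    p₁ ∘ u ≈ q₁ → p₂ ∘ u ≈ q₂ → q₁ ∘ v ≈ p₁ → q₂ ∘ v ≈ p₂ →
    u ∘ v ≈ id
  pullback-comparison {p₁ = p₁} {p₂} pb {u = u} {v} u₁ u₂ v₁ v₂ =
    ≈-trans (unique (u ∘ v) (through u₁ v₁) (through u₂ v₂))
            (≈-sym (unique id identityʳ identityʳ))
    where
      unique : ∀ w → p₁ ∘ w ≈ p₁ → p₂ ∘ w ≈ p₂ →
               w ≈ proj₁ (IsPullback.universal pb p₁ p₂ (IsPullback.commute pb))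
      unique = proj₂ (proj₂ (proj₂ (IsPullback.universal pb p₁ p₂ (IsPullback.commute pb))))
      through : ∀ {Y} {p : Hom _ Y} {q} → p ∘ u ≈ q → q ∘ v ≈ p → p ∘ (u ∘ v) ≈ p
      through e e' = ≈-trans (≈-sym assoc) (≈-trans (∘-resp-≈ e ≈-refl) e')

  pushout-comparison :
    ∀ {A B C D X} {m : Hom A B} {n : Hom A C} {g : Hom B D} {k : Hom C D} →
    IsPushout m n g k → {i₁ : Hom B X} {i₂ : Hom C X} {u : Hom D X} {v : Hom X D} →
    u ∘ g ≈ i₁ → u ∘ k ≈ i₂ → v ∘ i₁ ≈ g → v ∘ i₂ ≈ k → v ∘ u ≈ id
  pushout-comparison {g = g} {k} po {u = u} {v} u₁ u₂ v₁ v₂ =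
    ≈-trans (unique (v ∘ u) (through u₁ v₁) (through u₂ v₂))
            (≈-sym (unique id identityˡ identityˡ))
    where
      unique : ∀ w → w ∘ g ≈ g → w ∘ k ≈ k →
               w ≈ proj₁ (IsPushout.universal po g k (IsPushout.commute po))
      unique = proj₂ (proj₂ (proj₂ (IsPushout.universal po g k (IsPushout.commute po))))
      through : ∀ {Y} {p : Hom Y _} {q} → u ∘ p ≈ q → v ∘ q ≈ p → (v ∘ u) ∘ p ≈ p
      through e e' = ≈-trans assoc (≈-trans (∘-resp-≈ ≈-refl e) e')

open CatNotions CoalgF₁

_⊎G : ∀ {G H} → GHom G H → Func (V G ⊎ₛ E G) (V H ⊎ₛ E H)
h ⊎G = fV h ⊎F fE h

≈G-pw⊎ : ∀ {G H H' K} {g : GHom H K} {f : GHom G H} {g' : GHom H' K} {f' : GHom G H'} →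
         (g ∘G f) ≈G (g' ∘G f') → ∀ z →
         Setoid._≈_ (V K ⊎ₛ E K) (to (g ⊎G) (to (f ⊎G) z)) (to (g' ⊎G) (to (f' ⊎G) z))
≈G-pw⊎ (p , q) (inj₁ x) = inj₁ (p x)
≈G-pw⊎ (p , q) (inj₂ x) = inj₂ (q x)

-- The componentwise
-- mediator preserves neighbourhoods because p₁, a pullback of m, is injective.
module PullbackFromComponents {P B C D : Graph}
  (p₁ : GHom P B) (p₂ : GHom P C) (f : GHom B D) (m : GHom C D)
  (m∈M : M₁ m) (commutes : (f ∘G p₁) ≈G (m ∘G p₂))
  (pbV : SetPullback (fV p₁) (fV p₂) (fV f) (fV m))
  (pbE : SetPullback (fE p₁) (fE p₂) (fE f) (fE m)) where
  private
    module SB = Setoid (V B ⊎ₛ E B)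
    module SC = Setoid (V C ⊎ₛ E C)
    module SD = Setoid (V D ⊎ₛ E D)

    pb⊎ : SetPullback (p₁ ⊎G) (p₂ ⊎G) (f ⊎G) (m ⊎G)
    pb⊎ = ⊎-SetPullback pbV pbE

    m⊎-inj : Inj (m ⊎G)
    m⊎-inj = ⊎-inj (proj₁ m∈M) (proj₂ m∈M)

    commutes⊎ : ∀ z → to (f ⊎G) (to (p₁ ⊎G) z) SD.≈ to (m ⊎G) (to (p₂ ⊎G) z)
    commutes⊎ = ≈G-pw⊎ {g = f} {f = p₁} {g' = m} {f' = p₂} commutes

    p₁⊎-inj : Inj (p₁ ⊎G)
    p₁⊎-inj = SetPullback-inj pb⊎ commutes⊎ m⊎-inj

  module Mediator {X : Graph} (q₁ : GHom X B) (q₂ : GHom X C)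
                  (qe : (f ∘G q₁) ≈G (m ∘G q₂)) where
    uV : Func (V X) (V P)
    uV = proj₁ (SetPullback-mediator pbV (fV q₁) (fV q₂) (proj₁ qe))

    uV-over : ((fV p₁ ∘F uV) ≗F fV q₁) × ((fV p₂ ∘F uV) ≗F fV q₂)
    uV-over = proj₂ (SetPullback-mediator pbV (fV q₁) (fV q₂) (proj₁ qe))

    uE : Func (E X) (E P)
    uE = proj₁ (SetPullback-mediator pbE (fE q₁) (fE q₂) (proj₂ qe))

    uE-over : ((fE p₁ ∘F uE) ≗F fE q₁) × ((fE p₂ ∘F uE) ≗F fE q₂)
    uE-over = proj₂ (SetPullback-mediator pbE (fE q₁) (fE q₂) (proj₂ qe))

    private
      u⊎ : Func (V X ⊎ₛ E X) (V P ⊎ₛ E P)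
      u⊎ = uV ⊎F uE

      over-q₁ : ∀ z → to (p₁ ⊎G) (to u⊎ z) SB.≈ to (q₁ ⊎G) z
      over-q₁ = ⊎-square (proj₁ uV-over) (proj₁ uE-over)
      over-q₂ : ∀ z → to (p₂ ⊎G) (to u⊎ z) SC.≈ to (q₂ ⊎G) z
      over-q₂ = ⊎-square (proj₂ uV-over) (proj₂ uE-over)

      same-image : ∀ e → image (p₁ ⊎G) (c P (to uE e)) ≐ image (q₁ ⊎G) (c X e)
      same-image e = begin
        image (p₁ ⊎G) (c P (to uE e))  ≈⟨ comm p₁ (to uE e) ⟩
        c B (to (fE p₁) (to uE e))     ≈⟨ c-cong B (proj₁ uE-over e) ⟩
        c B (to (fE q₁) e)             ≈⟨ comm q₁ e ⟨
        image (q₁ ⊎G) (c X e)          ∎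
        where open SetoidReasoning (SubsetSetoid (V B ⊎ₛ E B))

      preserves-neighbourhoods : ∀ e → image u⊎ (c X e) ≐ c P (to uE e)
      preserves-neighbourhoods e y = into , from
        where
          -- p₁ is injective, so  u z  is the element of c P (u e) above q₁ z.
          into : mem (image u⊎ (c X e)) y → mem (c P (to uE e)) y
          into (z , z∈ , uz≈y) =
            let (s , s∈ , p₁s≈) = proj₂ (same-image e (to (q₁ ⊎G) z)) (z , z∈ , SB.refl)
                p₁s≈p₁y = SB.trans p₁s≈
                            (SB.trans (SB.sym (over-q₁ z)) (cong (p₁ ⊎G) uz≈y))
            in resp (c P (to uE e)) (p₁⊎-inj p₁s≈p₁y) s∈
          -- y and  u z  agree under p₁, and under p₂ because m is injective.
          from : mem (c P (to uE e)) y → mem (image u⊎ (c X e)) y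
          from y∈ =
            let (z , z∈ , q₁z≈) = proj₁ (same-image e (to (p₁ ⊎G) y)) (y , y∈ , SB.refl)
                qe⊎ = ≈G-pw⊎ {g = f} {f = q₁} {g' = m} {f' = q₂} qe z
                q₂z≈ = m⊎-inj (SD.trans (SD.sym qe⊎)
                                (SD.trans (cong (f ⊎G) q₁z≈) (commutes⊎ y)))
            in z , z∈ , jointly-injective pb⊎ (SB.trans (over-q₁ z) q₁z≈)
                                              (SC.trans (over-q₂ z) q₂z≈)

    mediator : GHom X P
    mediator = record { fV = uV ; fE = uE ; comm = preserves-neighbourhoods }

  isPullback : IsPullback p₁ p₂ f m
  isPullback = record
    { commute = commutes
    ; universal = λ q₁ q₂ qe → let open Mediator q₁ q₂ qe in
        mediator ,
        (proj₁ uV-over , proj₁ uE-over) ,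
        (proj₂ uV-over , proj₂ uE-over) ,
        -- uniqueness is joint injectivity of the projections in each component
        λ u' e₁ e₂ →
          (λ x → jointly-injective pbV
                   (Setoid.trans (V B) (proj₁ e₁ x) (Setoid.sym (V B) (proj₁ uV-over x)))
                   (Setoid.trans (V C) (proj₁ e₂ x) (Setoid.sym (V C) (proj₂ uV-over x)))) ,
          (λ x → jointly-injective pbE
                   (Setoid.trans (E B) (proj₂ e₁ x) (Setoid.sym (E B) (proj₁ uE-over x)))
                   (Setoid.trans (E C) (proj₂ e₂ x) (Setoid.sym (E C) (proj₂ uE-over x)))) }

module CanonicalPullback {B C D : Graph} (f : GHom B D) (m : GHom C D) where
  private
    module SB = Setoid (V B ⊎ₛ E B)
    module SC = Setoid (V C ⊎ₛ E C)
    module SD = Setoid (V D ⊎ₛ E D)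

    PV PE : SetS
    PV = PullbackSetoid (fV f) (fV m)
    PE = PullbackSetoid (fE f) (fE m)

    π₁⊎ : Func (PV ⊎ₛ PE) (V B ⊎ₛ E B)
    π₁⊎ = π₁ (fV f) (fV m) ⊎F π₁ (fE f) (fE m)

    π₂⊎ : Func (PV ⊎ₛ PE) (V C ⊎ₛ E C)
    π₂⊎ = π₂ (fV f) (fV m) ⊎F π₂ (fE f) (fE m)

    pb⊎ : SetPullback π₁⊎ π₂⊎ (f ⊎G) (m ⊎G)
    pb⊎ = ⊎-SetPullback (PullbackSetoid-isPullback (fV f) (fV m))
                        (PullbackSetoid-isPullback (fE f) (fE m))

  P₀ : Graph
  P₀ = record
    { V = PV
    ; E = PE
    ; c = λ e → record
        { mem = λ z → mem (c B (proj₁ (proj₁ e))) (to π₁⊎ z) ×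
                      mem (c C (proj₂ (proj₁ e))) (to π₂⊎ z)
        ; resp = λ eq (s , t) → resp (c B _) (cong π₁⊎ eq) s , resp (c C _) (cong π₂⊎ eq) t }
    ; c-cong = λ (eb , ec) z →
        (λ (s , t) → proj₁ (c-cong B eb (to π₁⊎ z)) s ,
                     proj₁ (c-cong C ec (to π₂⊎ z)) t) ,
        (λ (s , t) → proj₂ (c-cong B eb (to π₁⊎ z)) s ,
                     proj₂ (c-cong C ec (to π₂⊎ z)) t) }

  -- Every neighbour w of e_B has a partner: f w is a neighbour of f e_B = m e_C,
  -- hence the m-image of a neighbour of e_C.
  π₁G : GHom P₀ B
  π₁G = record { fV = π₁ (fV f) (fV m) ; fE = π₁ (fE f) (fE m) ; comm = neighbourhoods }
    where
      neighbourhoods : ∀ e → image π₁⊎ (c P₀ e) ≐ c B (proj₁ (proj₁ e))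
      neighbourhoods ((b , cc) , q) w =
        (λ { (z , (s , t) , eq) → resp (c B b) eq s }) ,
        (λ w∈ →
          let fw∈ = proj₁ (comm f b (to (f ⊎G) w)) (w , w∈ , SD.refl)
              mw∈ = proj₁ (c-cong D q (to (f ⊎G) w)) fw∈
              (t , t∈ , mt≈) = proj₂ (comm m cc (to (f ⊎G) w)) mw∈
              (z , e₁ , e₂) = lift-pair pb⊎ (SD.sym mt≈)
          in z , (resp (c B b) (SB.sym e₁) w∈ , resp (c C cc) (SC.sym e₂) t∈) , e₁)

  π₂G : GHom P₀ C
  π₂G = record { fV = π₂ (fV f) (fV m) ; fE = π₂ (fE f) (fE m) ; comm = neighbourhoods }
    where
      neighbourhoods : ∀ e → image π₂⊎ (c P₀ e) ≐ c C (proj₂ (proj₁ e))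
      neighbourhoods ((b , cc) , q) w =
        (λ { (z , (s , t) , eq) → resp (c C cc) eq t }) ,
        (λ w∈ →
          let mw∈ = proj₁ (comm m cc (to (m ⊎G) w)) (w , w∈ , SD.refl)
              fw∈ = proj₂ (c-cong D q (to (m ⊎G) w)) mw∈
              (s , s∈ , fs≈) = proj₂ (comm f b (to (m ⊎G) w)) fw∈
              (z , e₁ , e₂) = lift-pair pb⊎ fs≈
          in z , (resp (c B b) (SB.sym e₁) s∈ , resp (c C cc) (SC.sym e₂) w∈) , e₂)

  isPullback₀ : M₁ m → IsPullback π₁G π₂G f m
  isPullback₀ m∈M = PullbackFromComponents.isPullback π₁G π₂G f m m∈M (proj₂ , proj₂)
    (PullbackSetoid-isPullback (fV f) (fV m)) (PullbackSetoid-isPullback (fE f) (fE m))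

-- Conversely, both components of a pullback along m ∈ M are pullbacks of
-- setoids: it is isomorphic to the canonical one, which is componentwise.
module PullbackToComponents {P B C D : Graph} {p₁ : GHom P B} {p₂ : GHom P C}
  {f : GHom B D} {m : GHom C D} (m∈M : M₁ m) (pb : IsPullback p₁ p₂ f m) where
  open CanonicalPullback f m
  private
    pb₀ : IsPullback π₁G π₂G f m
    pb₀ = isPullback₀ m∈M

    v : GHom P P₀
    v = proj₁ (IsPullback.universal pb₀ p₁ p₂ (IsPullback.commute pb))

    v-over : ((π₁G ∘G v) ≈G p₁) × ((π₂G ∘G v) ≈G p₂)
    v-over = let (_ , v₁ , v₂ , _) = IsPullback.universal pb₀ p₁ p₂ (IsPullback.commute pb)
             in v₁ , v₂

    u : GHom P₀ P
    u = proj₁ (IsPullback.universal pb π₁G π₂G (IsPullback.commute pb₀))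

    u-over : ((p₁ ∘G u) ≈G π₁G) × ((p₂ ∘G u) ≈G π₂G)
    u-over = let (_ , u₁ , u₂ , _) = IsPullback.universal pb π₁G π₂G (IsPullback.commute pb₀)
             in u₁ , u₂

    uv≈id : (u ∘G v) ≈G idG
    uv≈id = pullback-comparison CoalgF₁ pb {q₁ = π₁G} {q₂ = π₂G} {u = u} {v = v}
              (proj₁ u-over) (proj₂ u-over) (proj₁ v-over) (proj₂ v-over)

  pbV : SetPullback (fV p₁) (fV p₂) (fV f) (fV m)
  pbV = SetPullback-transfer (PullbackSetoid-isPullback (fV f) (fV m))
          (fV v) (proj₁ (proj₁ v-over)) (proj₁ (proj₂ v-over))
          (fV u) (proj₁ (proj₁ u-over)) (proj₁ (proj₂ u-over)) (proj₁ uv≈id)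

  pbE : SetPullback (fE p₁) (fE p₂) (fE f) (fE m)
  pbE = SetPullback-transfer (PullbackSetoid-isPullback (fE f) (fE m))
          (fE v) (proj₂ (proj₁ v-over)) (proj₂ (proj₂ v-over))
          (fE u) (proj₂ (proj₁ u-over)) (proj₂ (proj₂ u-over)) (proj₂ uv≈id)

image-along : ∀ {Y Z : Graph} {W : SetS} (φ : Func (V Z ⊎ₛ E Z) W) (h : GHom Y Z)
              (y : Car (E Y)) → image φ (c Z (to (fE h) y)) ≐ image (φ ∘F (h ⊎G)) (c Y y)
image-along {Y} {Z} {W} φ h y = begin
  image φ (c Z (to (fE h) y))
    ≈⟨ image-cong φ {image (h ⊎G) (c Y y)} {c Z (to (fE h) y)} (comm h y) ⟨
  image φ (image (h ⊎G) (c Y y))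
    ≈⟨ image-∘ φ (h ⊎G) (c Y y) ⟩
  image (φ ∘F (h ⊎G)) (c Y y)
    ∎
  where open SetoidReasoning (SubsetSetoid W)

-- The componentwise mediator
-- preserves neighbourhoods because every edge of D comes from B or C.
module PushoutFromComponents {A B C D : Graph}
  (m : GHom A B) (n : GHom A C) (g : GHom B D) (k : GHom C D)
  (commutes : (g ∘G m) ≈G (k ∘G n))
  (poV : SetPushout (fV m) (fV n) (fV g) (fV k))
  (poE : SetPushout (fE m) (fE n) (fE g) (fE k)) where

  module Mediator {X : Graph} (p : GHom B X) (q : GHom C X) (pq : (p ∘G m) ≈G (q ∘G n)) where
    module MV = Gluing.SetPushoutMediator (fV m) (fV n) poV (fV p) (fV q) (proj₁ pq)
    module ME = Gluing.SetPushoutMediator (fE m) (fE n) poE (fE p) (fE q) (proj₂ pq)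

    private
      module DE = Setoid (E D)
      u⊎ : Func (V D ⊎ₛ E D) (V X ⊎ₛ E X)
      u⊎ = MV.mediator ⊎F ME.mediator

      open SetoidReasoning (SubsetSetoid (V X ⊎ₛ E X))

      along-leg : ∀ {Y} (h : GHom Y D) (r : GHom Y X) →
                  (∀ x → Setoid._≈_ (V X) (to MV.mediator (to (fV h) x)) (to (fV r) x)) →
                  (∀ y → Setoid._≈_ (E X) (to ME.mediator (to (fE h) y)) (to (fE r) y)) →
                  ∀ y {e} → to (fE h) y DE.≈ e → image u⊎ (c D e) ≐ c X (to (fE r) y)
      along-leg {Y} h r hrV hrE y {e} hy≈e = begin
        image u⊎ (c D e)
          ≈⟨ image-cong u⊎ {c D (to (fE h) y)} {c D e} (c-cong D hy≈e) ⟨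
        image u⊎ (c D (to (fE h) y))
          ≈⟨ image-along u⊎ h y ⟩
        image (u⊎ ∘F (h ⊎G)) (c Y y)
          ≈⟨ image-ext {f = u⊎ ∘F (h ⊎G)} {f' = r ⊎G} u⊎∘h≗r (c Y y) ⟩
        image (r ⊎G) (c Y y)
          ≈⟨ comm r y ⟩
        c X (to (fE r) y)
          ∎
        where
          u⊎∘h≗r : (u⊎ ∘F (h ⊎G)) ≗F (r ⊎G)
          u⊎∘h≗r = ⊎-square {h₁ = MV.mediator} {u₁ = fV h} {q₁ = fV r}
                            {h₂ = ME.mediator} {u₂ = fE h} {q₂ = fE r} hrV hrE

      preserves-from : ∀ e (x : Car (E B) ⊎ Car (E C)) →
                       copair (fE m) (fE n) (fE g) (fE k) x DE.≈ e →
                       image u⊎ (c D e) ≐ c X (copair (fE m) (fE n) (fE p) (fE q) x)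
      preserves-from e (inj₁ b) = along-leg g p MV.mediator-g ME.mediator-g b
      preserves-from e (inj₂ cc) = along-leg k q MV.mediator-k ME.mediator-k cc

    mediator : GHom D X
    mediator = record
      { fV = MV.mediator ; fE = ME.mediator
      ; comm = λ e → preserves-from e (proj₁ (jointly-surjective poE e))
                                      (proj₂ (jointly-surjective poE e)) }

  isPushout : IsPushout m n g k
  isPushout = record
    { commute = commutes
    ; universal = λ p q pq → let open Mediator p q pq in
        mediator , (MV.mediator-g , ME.mediator-g) , (MV.mediator-k , ME.mediator-k) ,
        λ u' e₁ e₂ → MV.mediator-unique (fV u') (proj₁ e₁) (proj₁ e₂) ,
                     ME.mediator-unique (fE u') (proj₂ e₁) (proj₂ e₂) }

module CanonicalPushout {A B C : Graph} (m : GHom A B) (n : GHom A C) (m∈M : M₁ m) where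
  module GV = Gluing.CanonicalPushout (fV m) (fV n) (proj₁ m∈M)
  module GE = Gluing.CanonicalPushout (fE m) (fE n) (proj₂ m∈M)

  private
    S : SetS
    S = GV.PushoutSetoid ⊎ₛ GE.PushoutSetoid
    module BE = Setoid (E B)
    module CE = Setoid (E C)
    ι₁⊎ : Func (V B ⊎ₛ E B) S
    ι₁⊎ = GV.ι₁ ⊎F GE.ι₁
    ι₂⊎ : Func (V C ⊎ₛ E C) S
    ι₂⊎ = GV.ι₂ ⊎F GE.ι₂
    open SetoidReasoning (SubsetSetoid S)

    nb₁ : Car (E B) → Subset S
    nb₁ b = image ι₁⊎ (c B b)

    nb₂ : Car (E C) → Subset S
    nb₂ cc = image ι₂⊎ (c C cc)

    nb₁-cong : ∀ {b b'} → b BE.≈ b' → nb₁ b ≐ nb₁ b'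
    nb₁-cong {b} {b'} e = image-cong ι₁⊎ {c B b} {c B b'} (c-cong B e)

    nb₂-cong : ∀ {c₁ c₂} → c₁ CE.≈ c₂ → nb₂ c₁ ≐ nb₂ c₂
    nb₂-cong {c₁} {c₂} e = image-cong ι₂⊎ {c C c₁} {c C c₂} (c-cong C e)

    ι-commute⊎ : (ι₁⊎ ∘F (m ⊎G)) ≗F (ι₂⊎ ∘F (n ⊎G))
    ι-commute⊎ (inj₁ x) = inj₁ (GV.ι-commute x)
    ι-commute⊎ (inj₂ x) = inj₂ (GE.ι-commute x)

    nb-glued : ∀ a → nb₁ (to (fE m) a) ≐ nb₂ (to (fE n) a)
    nb-glued a = begin
      image ι₁⊎ (c B (to (fE m) a))
        ≈⟨ image-along ι₁⊎ m a ⟩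
      image (ι₁⊎ ∘F (m ⊎G)) (c A a)
        ≈⟨ image-ext {f = ι₁⊎ ∘F (m ⊎G)} {f' = ι₂⊎ ∘F (n ⊎G)} ι-commute⊎ (c A a) ⟩
      image (ι₂⊎ ∘F (n ⊎G)) (c A a)
        ≈⟨ image-along ι₂⊎ n a ⟨
      image ι₂⊎ (c C (to (fE n) a))
        ∎

    nb : Car GE.PushoutSetoid → Subset S
    nb (inj₁ b) = nb₁ b
    nb (inj₂ cc) = nb₂ cc

    nb-cong : ∀ {x y} → Glued (fE m) (fE n) x y → nb x ≐ nb y
    nb-cong {inj₁ b} {inj₁ b'} (inj₁ e) = nb₁-cong e
    nb-cong {inj₁ b} {inj₁ b'} (inj₂ (a , a' , e₁ , e₂ , e₃)) = begin
      nb₁ b               ≈⟨ nb₁-cong e₁ ⟨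
      nb₁ (to (fE m) a)   ≈⟨ nb-glued a ⟩
      nb₂ (to (fE n) a)   ≈⟨ nb₂-cong e₃ ⟩
      nb₂ (to (fE n) a')  ≈⟨ nb-glued a' ⟨
      nb₁ (to (fE m) a')  ≈⟨ nb₁-cong e₂ ⟩
      nb₁ b'              ∎
    nb-cong {inj₁ b} {inj₂ cc} (a , e₁ , e₂) = begin
      nb₁ b               ≈⟨ nb₁-cong e₁ ⟨
      nb₁ (to (fE m) a)   ≈⟨ nb-glued a ⟩
      nb₂ (to (fE n) a)   ≈⟨ nb₂-cong e₂ ⟩
      nb₂ cc              ∎
    nb-cong {inj₂ cc} {inj₁ b} (a , e₁ , e₂) = begin
      nb₂ cc              ≈⟨ nb₂-cong e₂ ⟨
      nb₂ (to (fE n) a)   ≈⟨ nb-glued a ⟨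
      nb₁ (to (fE m) a)   ≈⟨ nb₁-cong e₁ ⟩
      nb₁ b               ∎
    nb-cong {inj₂ cc} {inj₂ cc'} e = nb₂-cong e

  D₀ : Graph
  D₀ = record { V = GV.PushoutSetoid ; E = GE.PushoutSetoid
               ; c = nb ; c-cong = λ {x} {y} → nb-cong {x} {y} }

  g₀ : GHom B D₀
  g₀ = record { fV = GV.ι₁ ; fE = GE.ι₁ ; comm = λ b → ≐-refl {S} {nb₁ b} }

  k₀ : GHom C D₀
  k₀ = record { fV = GV.ι₂ ; fE = GE.ι₂ ; comm = λ cc → ≐-refl {S} {nb₂ cc} }

  isPushout₀ : IsPushout m n g₀ k₀
  isPushout₀ = PushoutFromComponents.isPushout m n g₀ k₀ (GV.ι-commute , GE.ι-commute)
                 GV.PushoutSetoid-isPushout GE.PushoutSetoid-isPushout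

-- Conversely, both components of a pushout along m ∈ M are pushouts of
-- setoids: it is isomorphic to the canonical one, which is componentwise.
module PushoutToComponents {A B C D : Graph} {m : GHom A B} {n : GHom A C}
  {g : GHom B D} {k : GHom C D} (m∈M : M₁ m) (po : IsPushout m n g k) where
  open CanonicalPushout m n m∈M
  private
    u : GHom D D₀
    u = proj₁ (IsPushout.universal po g₀ k₀ (IsPushout.commute isPushout₀))

    u-under : ((u ∘G g) ≈G g₀) × ((u ∘G k) ≈G k₀)
    u-under = let (_ , u₁ , u₂ , _) = IsPushout.universal po g₀ k₀ (IsPushout.commute isPushout₀)
              in u₁ , u₂

    v : GHom D₀ D
    v = proj₁ (IsPushout.universal isPushout₀ g k (IsPushout.commute po))

    v-under : ((v ∘G g₀) ≈G g) × ((v ∘G k₀) ≈G k)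
    v-under = let (_ , v₁ , v₂ , _) = IsPushout.universal isPushout₀ g k (IsPushout.commute po)
              in v₁ , v₂

    vu≈id : (v ∘G u) ≈G idG
    vu≈id = pushout-comparison CoalgF₁ po {i₁ = g₀} {i₂ = k₀} {u = u} {v = v}
              (proj₁ u-under) (proj₂ u-under) (proj₁ v-under) (proj₂ v-under)

  poV : SetPushout (fV m) (fV n) (fV g) (fV k)
  poV = Gluing.SetPushout-transfer (fV m) (fV n) GV.PushoutSetoid-isPushout
          (fV u) (proj₁ (proj₁ u-under)) (proj₁ (proj₂ u-under))
          (fV v) (proj₁ (proj₁ v-under)) (proj₁ (proj₂ v-under)) (proj₁ vu≈id)

  poE : SetPushout (fE m) (fE n) (fE g) (fE k)
  poE = Gluing.SetPushout-transfer (fE m) (fE n) GE.PushoutSetoid-isPushout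
          (fE u) (proj₂ (proj₁ u-under)) (proj₂ (proj₂ u-under))
          (fE v) (proj₂ (proj₁ v-under)) (proj₂ (proj₂ v-under)) (proj₂ vu≈id)

ComponentPullbacks : ∀ {P B C D : Graph} →
                     GHom P B → GHom P C → GHom B D → GHom C D → Set
ComponentPullbacks p₁ p₂ f m =
  SetPullback (fV p₁) (fV p₂) (fV f) (fV m) × SetPullback (fE p₁) (fE p₂) (fE f) (fE m)

-- The translations between pullbacks and their components, when the M-leg
-- of the cospan is f rather than m.
module _ {P B C D : Graph} {p₁ : GHom P B} {p₂ : GHom P C} {f : GHom B D} {m : GHom C D}
         (f∈M : M₁ f) where
  pullback-from-components-left :
    (f ∘G p₁) ≈G (m ∘G p₂) → ComponentPullbacks p₁ p₂ f m → IsPullback p₁ p₂ f m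
  pullback-from-components-left commutes (pbV , pbE) = pullback-swap CoalgF₁
    (PullbackFromComponents.isPullback p₂ p₁ m f f∈M
       (Category.≈-sym CoalgF₁ {f = f ∘G p₁} {g = m ∘G p₂} commutes)
       (SetPullback-swap pbV) (SetPullback-swap pbE))

  pullback-components-left : IsPullback p₁ p₂ f m → ComponentPullbacks p₁ p₂ f m
  pullback-components-left pb =
    SetPullback-swap (PullbackToComponents.pbV f∈M (pullback-swap CoalgF₁ pb)) ,
    SetPullback-swap (PullbackToComponents.pbE f∈M (pullback-swap CoalgF₁ pb))

pushout-preserves-M : ∀ {A B C D} {m : GHom A B} {n : GHom A C}
                        {g : GHom B D} {k : GHom C D} →
                      IsPushout m n g k → M₁ m → M₁ k
pushout-preserves-M {m = m} {n} po m∈M =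
  SetPushout-inj (fV m) (fV n) (PushoutToComponents.poV m∈M po) ,
  SetPushout-inj (fE m) (fE n) (PushoutToComponents.poE m∈M po)

pullback-preserves-M : ∀ {P B C D} {p₁ : GHom P B} {p₂ : GHom P C}
                         {f : GHom B D} {m : GHom C D} →
                       IsPullback p₁ p₂ f m → M₁ m → M₁ p₁
pullback-preserves-M pb m∈M =
  SetPullback-inj (PullbackToComponents.pbV m∈M pb) (proj₁ (IsPullback.commute pb)) (proj₁ m∈M) ,
  SetPullback-inj (PullbackToComponents.pbE m∈M pb) (proj₂ (IsPullback.commute pb)) (proj₂ m∈M)

-- Vertical weak van Kampen squares in Coalg_{F₁}: translate every face of the
-- cube into its components, apply 'VanKampenSets' to vertices and to edges,
-- and translate back.  (The vertical map a need not be in M.)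
module VanKampenGraphs {A B C D A' B' C' D' : Graph}
  {m : GHom A B} {n : GHom A C} {g : GHom B D} {k : GHom C D}
  {m' : GHom A' B'} {n' : GHom A' C'} {g' : GHom B' D'} {k' : GHom C' D'}
  {a : GHom A' A} {b : GHom B' B} {c : GHom C' C} {d : GHom D' D}
  (m∈M : M₁ m) (bottom : IsPushout m n g k)
  (top : (g' ∘G m') ≈G (k' ∘G n'))
  (back₁ : (b ∘G m') ≈G (m ∘G a)) (back₂ : (c ∘G n') ≈G (n ∘G a))
  (front₁ : (d ∘G g') ≈G (g ∘G b)) (front₂ : (d ∘G k') ≈G (k ∘G c))
  (b∈M : M₁ b) (c∈M : M₁ c) (d∈M : M₁ d)
  (back₁-pb : IsPullback m' a b m) (back₂-pb : IsPullback n' a c n) where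
  private
    back₂-components : ComponentPullbacks n' a c n
    back₂-components = pullback-components-left c∈M back₂-pb

    module VK-V = VanKampenSets {g' = fV g'} {k' = fV k'} {d = fV d}
      (proj₁ top) (proj₁ back₁) (proj₁ back₂) (proj₁ front₁) (proj₁ front₂)
      (proj₁ b∈M) (proj₁ c∈M) (PushoutToComponents.poV m∈M bottom)
      (PullbackToComponents.pbV m∈M back₁-pb) (proj₁ back₂-components)
    module VK-E = VanKampenSets {g' = fE g'} {k' = fE k'} {d = fE d}
      (proj₂ top) (proj₂ back₁) (proj₂ back₂) (proj₂ front₁) (proj₂ front₂)
      (proj₂ b∈M) (proj₂ c∈M) (PushoutToComponents.poE m∈M bottom)
      (PullbackToComponents.pbE m∈M back₁-pb) (proj₂ back₂-components)

  top-pushout⇒front-pullbacks :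
    IsPushout m' n' g' k' → IsPullback g' b d g × IsPullback k' c d k
  top-pushout⇒front-pullbacks top-po =
    pullback-from-components-left d∈M front₁
      (VK-V.front₁-pullback topV , VK-E.front₁-pullback topE) ,
    pullback-from-components-left d∈M front₂
      (VK-V.front₂-pullback topV , VK-E.front₂-pullback topE)
    where
      m'∈M : M₁ m'
      m'∈M = pullback-preserves-M back₁-pb m∈M
      topV : SetPushout (fV m') (fV n') (fV g') (fV k')
      topV = PushoutToComponents.poV m'∈M top-po
      topE : SetPushout (fE m') (fE n') (fE g') (fE k')
      topE = PushoutToComponents.poE m'∈M top-po

  front-pullbacks⇒top-pushout :
    IsPullback g' b d g × IsPullback k' c d k → IsPushout m' n' g' k'
  front-pullbacks⇒top-pushout (front₁-pb , front₂-pb) =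
    PushoutFromComponents.isPushout m' n' g' k' top
      (VK-V.top-pushout (proj₁ front₁-components) (proj₁ front₂-components))
      (VK-E.top-pushout (proj₂ front₁-components) (proj₂ front₂-components))
    where
      front₁-components : ComponentPullbacks g' b d g
      front₁-components = pullback-components-left d∈M front₁-pb
      front₂-components : ComponentPullbacks k' c d k
      front₂-components = pullback-components-left d∈M front₂-pb

lemma11 : ExcludedMiddle 0ℓ → CatNotions.MAdhesive CoalgF₁ M₁
lemma11 _ = record
  { M-mono = λ (fV-inj , fE-inj) g k e →
      (λ x → fV-inj (proj₁ e x)) , (λ x → fE-inj (proj₂ e x))
  ; M-id = (λ e → e) , (λ e → e)
  ; M-∘ = λ (f₁ , f₂) (g₁ , g₂) → (λ e → f₁ (g₁ e)) , (λ e → f₂ (g₂ e))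
  ; pushout-along-M = λ m n m∈M →
      let open CanonicalPushout m n m∈M in D₀ , g₀ , k₀ , isPushout₀
  ; pushout-stable = pushout-preserves-M
  ; pullback-along-M = λ f m m∈M →
      let open CanonicalPullback f m in P₀ , π₁G , π₂G , isPullback₀ m∈M
  ; pullback-stable = pullback-preserves-M
  ; vertical-weak-VK = λ m∈M po top bk₁ bk₂ fr₁ fr₂ _ b∈M c∈M d∈M pb₁ pb₂ →
      let open VanKampenGraphs m∈M po top bk₁ bk₂ fr₁ fr₂ b∈M c∈M d∈M pb₁ pb₂
      in top-pushout⇒front-pullbacks , front-pullbacks⇒top-pushout }
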